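{- Let $P$ be any path with at least $4$ vertices. Then $1=h(P)<mh(P)=2$.
   Context: Hunters and Rabbit game on a graph $G=(V,E)$. A hunter strategy is a finite sequence $(S_1,\dots,S_\ell)$ of non-empty subsets of $V$, using $\max_i|S_i|$ hunters. A rabbit trajectory is a walk $(r_0,\dots,r_\ell)$ in $G$ ($r_i\in N(r_{i-1})$); the strategy is winning if every rabbit trajectory has some $j<\ell$ with $r_j\in S_{j+1}$. $h(G)$ is the minimum number of hunters of a winning hunter strategy. Contaminated sets: $Z_0=V$, $Z_i=\{x : \exists y\in Z_{i-1}\setminus S_i,\ xy\in E\}$. A vertex $v$ is cleared at round $i$ if $v\in S_i$, or $N(v)\cap Z_{i-1}\ne\emptyset$ and $N(v)\cap Z_{i-1}\subseteq S_i$. A strategy is monotone if any vertex $v$ cleared at some round $i$ satisfies $v\in S_{j+1}$ whenever $j>i$ and $v\in Z_j$. $mh(G)$ is the minimum number of hunters of a monotone winning hunter strategy. -}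

module Defs where

open import Data.Nat using (ℕ; zero; suc; _⊔_; _≤_; _<_; _+_)
open import Data.Fin using (Fin; zero; suc; toℕ; inject₁)
open import Data.Fin.Subset using (Subset; _∈_; _∉_; ∣_∣; Nonempty) renaming (⊤ to ⊤ₛ)
open import Data.Vec using (Vec; []; _∷_; lookup)
open import Data.Product using (Σ; ∃; _×_; _,_)
open import Data.Sum using (_⊎_)
open import Data.Unit using (⊤)
open import Relation.Binary.PropositionalEquality using (_≡_)

Graph : ℕ → Set₁
Graph n = Fin n → Fin n → Set

PathG : (n : ℕ) → Graph n
PathG n i j = (suc (toℕ i) ≡ toℕ j) ⊎ (suc (toℕ j) ≡ toℕ i)

-- A hunter strategy (S_1,…,S_ℓ): a vector of ℓ subsets; S_{k+1} = lookup S k.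
record Strategy (n : ℕ) : Set where
  constructor strategy
  field
    len      : ℕ
    sets     : Vec (Subset n) len
    nonempty : (k : Fin len) → Nonempty (lookup sets k)
open Strategy public

maxCard : ∀ {n ℓ} → Vec (Subset n) ℓ → ℕ
maxCard []       = 0
maxCard (s ∷ ss) = ∣ s ∣ ⊔ maxCard ss

hunters : ∀ {n} → Strategy n → ℕ
hunters σ = maxCard (sets σ)

IsWalk : ∀ {n} → Graph n → (ℓ : ℕ) → (Fin (suc ℓ) → Fin n) → Set
IsWalk G ℓ r = (k : Fin ℓ) → G (r (inject₁ k)) (r (suc k))

Winning : ∀ {n} → Graph n → Strategy n → Set
Winning G σ = (r : Fin (suc (len σ)) → Fin _) → IsWalk G (len σ) r →
  ∃ λ (j : Fin (len σ)) → r (inject₁ j) ∈ lookup (sets σ) j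

-- contaminated sets Z_0,…,Z_ℓ (as predicates on vertices)
-- S_{i+1} indexed by a natural number i (only ever used for i < ℓ;
-- the out-of-range default is irrelevant)
Sℕ : ∀ {n ℓ} → Vec (Subset n) ℓ → ℕ → Subset n
Sℕ []       i       = ⊤ₛ
Sℕ (s ∷ ss) zero    = s
Sℕ (s ∷ ss) (suc i) = Sℕ ss i

Z : ∀ {n} → Graph n → (σ : Strategy n) → ℕ → Fin n → Set
Z G σ zero    x = ⊤
Z G σ (suc i) x = ∃ λ y → Z G σ i y × y ∉ Sℕ (sets σ) i × G x y

-- v is cleared at round k+1 (k : Fin ℓ)
Cleared : ∀ {n} → Graph n → (σ : Strategy n) → Fin (len σ) → Fin n → Set
Cleared G σ k v =
  v ∈ lookup (sets σ) k ⊎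
  ((∃ λ u → G v u × Z G σ (toℕ k) u) ×
   (∀ u → G v u → Z G σ (toℕ k) u → u ∈ lookup (sets σ) k))

Monotone : ∀ {n} → Graph n → Strategy n → Set
Monotone G σ = ∀ (v : Fin _) (k j : Fin (len σ)) → Cleared G σ k v →
  suc (toℕ k) < toℕ j → Z G σ (toℕ j) v → v ∈ lookup (sets σ) j

HunterNumber : ∀ {n} → Graph n → ℕ → Set
HunterNumber G m =
  (∃ λ σ → Winning G σ × hunters σ ≡ m) ×
  (∀ σ → Winning G σ → m ≤ hunters σ)

MonotoneHunterNumber : ∀ {n} → Graph n → ℕ → Set
MonotoneHunterNumber G m =
  (∃ λ σ → Winning G σ × Monotone G σ × hunters σ ≡ m) ×
  (∀ σ → Winning G σ → Monotone G σ → m ≤ hunters σ)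

module Submission where

-- A strategy wins exactly when its last contaminated set Z_ℓ is empty, so the argument is about
-- the sets Z_t. A hunter walking from one end of the path to the other cannot be passed by a rabbit
-- of the opposite parity; two such sweeps and, after one idle round, a third catch every rabbit, so
-- h(P) = 1. Two hunters sweeping an adjacent pair never leave contamination behind them, a monotone
-- strategy. A monotone single hunter, however, must stand on any vertex cleared at least two rounds
-- earlier as soon as it is contaminated again; this pins it down so much that, up to reflecting the
-- path, Z_t always has one of a few nonempty shapes once the path has four vertices.

open import Defs
open import Data.Nat using (ℕ; zero; suc; _+_; _∸_; _≤_; _<_; z≤n; s≤s; parity)
open import Data.Nat.Properties
open import Data.Parity.Base using (0ℙ; 1ℙ; _⁻¹)
open import Data.Parity.Properties using (⁻¹-selfInverse; p≢p⁻¹)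
open import Data.Fin using (Fin; zero; suc; toℕ; inject₁; fromℕ; fromℕ<)
open import Data.Fin.Properties using (toℕ-injective; toℕ<n; toℕ-fromℕ; toℕ-fromℕ<; toℕ-inject₁; any?)
open import Data.Fin.Subset using (Subset; _∈_; _∉_; ∣_∣; Nonempty; ⁅_⁆; _∪_; inside; outside)
open import Data.Fin.Subset.Properties
  using (_∈?_; x∈⁅x⁆; x∈⁅y⁆⇒x≡y; ∣⁅x⁆∣≡1; x∈p∪q⁺; x∈p∪q⁻; p⊆q⇒∣p∣≤∣q∣)
open import Data.Vec using (Vec; []; _∷_; lookup; tabulate; _++_; here; there)
open import Data.Vec.Properties using (lookup∘tabulate)
open import Data.Vec.Relation.Unary.All using (All; []; _∷_)
import Data.Vec.Relation.Unary.All as All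
open import Data.Vec.Relation.Unary.All.Properties using (lookup⁺; ++⁺; tabulate⁺)
open import Data.Product using (Σ; ∃; _×_; _,_; proj₁; proj₂)
open import Data.Sum using (_⊎_; inj₁; inj₂; [_,_]′)
open import Data.Unit using (tt)
open import Data.Empty using (⊥; ⊥-elim)
open import Function using (_∘_; id)
open import Relation.Nullary using (¬_; yes; no)
open import Relation.Binary.Definitions using (Symmetric)
open import Relation.Binary.PropositionalEquality

∣p∪q∣≤∣p∣+∣q∣ : ∀ {n} (p q : Subset n) → ∣ p ∪ q ∣ ≤ ∣ p ∣ + ∣ q ∣
∣p∪q∣≤∣p∣+∣q∣ []            []            = z≤n
∣p∪q∣≤∣p∣+∣q∣ (outside ∷ p) (outside ∷ q) = ∣p∪q∣≤∣p∣+∣q∣ p q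
∣p∪q∣≤∣p∣+∣q∣ (outside ∷ p) (inside ∷ q)  =
  ≤-trans (s≤s (∣p∪q∣≤∣p∣+∣q∣ p q)) (≤-reflexive (sym (+-suc _ _)))
∣p∪q∣≤∣p∣+∣q∣ (inside ∷ p)  (outside ∷ q) = s≤s (∣p∪q∣≤∣p∣+∣q∣ p q)
∣p∪q∣≤∣p∣+∣q∣ (inside ∷ p)  (inside ∷ q)  =
  s≤s (≤-trans (∣p∪q∣≤∣p∣+∣q∣ p q) (≤-trans (n≤1+n _) (≤-reflexive (sym (+-suc _ _)))))

x∈p⇒1≤∣p∣ : ∀ {n} {p : Subset n} {x} → x ∈ p → 1 ≤ ∣ p ∣
x∈p⇒1≤∣p∣ {p = p} {x} x∈p = subst (_≤ ∣ p ∣) (∣⁅x⁆∣≡1 x)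
  (p⊆q⇒∣p∣≤∣q∣ (λ y∈⁅x⁆ → subst (_∈ p) (sym (x∈⁅y⁆⇒x≡y x y∈⁅x⁆)) x∈p))

∣p∣≤1⇒≡ : ∀ {n} (p : Subset n) → ∣ p ∣ ≤ 1 → ∀ {x y} → x ∈ p → y ∈ p → x ≡ y
∣p∣≤1⇒≡ (inside ∷ p)  _           here        here        = refl
∣p∣≤1⇒≡ (inside ∷ p)  (s≤s ∣p∣≤0) here        (there y∈p) = ⊥-elim (1+n≰n (≤-trans (x∈p⇒1≤∣p∣ y∈p) ∣p∣≤0))
∣p∣≤1⇒≡ (inside ∷ p)  (s≤s ∣p∣≤0) (there x∈p) _           = ⊥-elim (1+n≰n (≤-trans (x∈p⇒1≤∣p∣ x∈p) ∣p∣≤0))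
∣p∣≤1⇒≡ (outside ∷ p) ∣p∣≤1       (there x∈p) (there y∈p) = cong suc (∣p∣≤1⇒≡ p ∣p∣≤1 x∈p y∈p)

module _ {n : ℕ} where

  Sℕ-lookup : ∀ {ℓ} (v : Vec (Subset n) ℓ) (k : Fin ℓ) → Sℕ v (toℕ k) ≡ lookup v k
  Sℕ-lookup (s ∷ v) zero    = refl
  Sℕ-lookup (s ∷ v) (suc k) = Sℕ-lookup v k

  Sℕ-tabulate : ∀ {ℓ} (f : Fin ℓ → Subset n) {k} (k<ℓ : k < ℓ) → Sℕ (tabulate f) k ≡ f (fromℕ< k<ℓ)
  Sℕ-tabulate f {zero}  (s≤s _)   = refl
  Sℕ-tabulate f {suc k} (s≤s k<ℓ) = Sℕ-tabulate (f ∘ suc) k<ℓ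

  Sℕ-++ˡ : ∀ {a b} (u : Vec (Subset n) a) (w : Vec (Subset n) b) {k} → k < a → Sℕ (u ++ w) k ≡ Sℕ u k
  Sℕ-++ˡ (s ∷ u) w {zero}  _         = refl
  Sℕ-++ˡ (s ∷ u) w {suc k} (s≤s k<a) = Sℕ-++ˡ u w k<a

  Sℕ-++ʳ : ∀ {a b} (u : Vec (Subset n) a) (w : Vec (Subset n) b) k → Sℕ (u ++ w) (a + k) ≡ Sℕ w k
  Sℕ-++ʳ []      w k = refl
  Sℕ-++ʳ (s ∷ u) w k = Sℕ-++ʳ u w k

  ∣lookup∣≤maxCard : ∀ {ℓ} (v : Vec (Subset n) ℓ) k → ∣ lookup v k ∣ ≤ maxCard v
  ∣lookup∣≤maxCard (s ∷ v) zero    = m≤m⊔n _ _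
  ∣lookup∣≤maxCard (s ∷ v) (suc k) = ≤-trans (∣lookup∣≤maxCard v k) (m≤n⊔m _ _)

  maxCard≤ : ∀ {ℓ c} {v : Vec (Subset n) ℓ} → All (λ s → ∣ s ∣ ≤ c) v → maxCard v ≤ c
  maxCard≤ []          = z≤n
  maxCard≤ (s≤c ∷ v≤c) = ⊔-lub s≤c (maxCard≤ v≤c)

  strategyOf : ∀ {ℓ} (v : Vec (Subset n) ℓ) → All Nonempty v → Strategy n
  strategyOf v nonempty = strategy _ v (lookup⁺ nonempty)

  winning⇒1≤hunters : ∀ {G : Graph n} → Fin n → (σ : Strategy n) → Winning G σ → 1 ≤ hunters σ
  winning⇒1≤hunters x (strategy zero [] _) win with win (λ _ → x) (λ ())
  ... | () , _
  winning⇒1≤hunters x (strategy (suc ℓ) (s ∷ v) nonempty) win =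
    ≤-trans (x∈p⇒1≤∣p∣ (proj₂ (nonempty zero))) (m≤m⊔n _ _)

module _ {n : ℕ} {G : Graph n} (G-sym : Symmetric G) (σ : Strategy n) where
  private
    ℓ = len σ
    S = Sℕ (sets σ)

  uncaught-contaminated : ∀ r → IsWalk G ℓ r → (∀ j → r (inject₁ j) ∉ lookup (sets σ) j) →
    ∀ i (k : Fin (suc ℓ)) → toℕ k ≡ i → Z G σ i (r k)
  uncaught-contaminated r walk uncaught zero    k       _ = tt
  uncaught-contaminated r walk uncaught (suc i) (suc k) k≡i =
    r (inject₁ k) ,
    uncaught-contaminated r walk uncaught i (inject₁ k) (trans (toℕ-inject₁ k) (suc-injective k≡i)) ,
    (λ r∈S → uncaught k (subst (r (inject₁ k) ∈_)
                                (trans (cong S (suc-injective (sym k≡i))) (Sℕ-lookup (sets σ) k)) r∈S)) ,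
    G-sym (walk k)

  Z-empty⇒winning : (∀ x → ¬ Z G σ ℓ x) → Winning G σ
  Z-empty⇒winning empty r walk with any? (λ j → r (inject₁ j) ∈? lookup (sets σ) j)
  ... | yes caught = caught
  ... | no uncaught = ⊥-elim (empty (r (fromℕ ℓ))
          (uncaught-contaminated r walk (λ j r∈S → uncaught (j , r∈S)) ℓ _ (toℕ-fromℕ ℓ)))

  -- The escaping walk is built backwards; `rest` is its already chosen part from time i on.
  escape : ∀ i x → Z G σ i x → (rest : ℕ → Fin n) → rest 0 ≡ x →
    Σ (ℕ → Fin n) λ w → (∀ d → w (i + d) ≡ rest d) × (∀ j → j < i → w j ∉ S j × G (w j) (w (suc j)))
  escape zero    x _ rest _ = rest , (λ _ → refl) , (λ _ ())
  escape (suc i) x (y , zy , y∉S , xy) rest refl with escape i y zy (λ { zero → y ; (suc d) → rest d }) refl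
  ... | w , w≡rest , safe = w , w≡rest′ , safe′
    where
    w≡rest′ : ∀ d → w (suc i + d) ≡ rest d
    w≡rest′ d = trans (cong w (sym (+-suc i d))) (w≡rest (suc d))
    safe′ : ∀ j → j < suc i → w j ∉ S j × G (w j) (w (suc j))
    safe′ j j<1+i with m<1+n⇒m<n∨m≡n j<1+i
    ... | inj₁ j<i = safe j j<i
    ... | inj₂ refl = subst (_∉ S i) (sym w-i≡y) y∉S , subst₂ G (sym w-i≡y) (sym w-1+i≡x) (G-sym xy)
      where
      w-i≡y : w i ≡ y
      w-i≡y = trans (cong w (sym (+-identityʳ i))) (w≡rest 0)
      w-1+i≡x : w (suc i) ≡ rest 0
      w-1+i≡x = trans (cong w (+-comm 1 i)) (w≡rest 1)

  winning⇒Z-empty : Winning G σ → ∀ x → ¬ Z G σ ℓ x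
  winning⇒Z-empty win x z with escape ℓ x z (λ _ → x) refl
  ... | w , _ , safe with win (w ∘ toℕ) walk
    where
    walk : IsWalk G ℓ (w ∘ toℕ)
    walk k = subst (λ i → G (w i) (w (suc (toℕ k)))) (sym (toℕ-inject₁ k)) (proj₂ (safe (toℕ k) (toℕ<n k)))
  ... | j , caught = proj₁ (safe (toℕ j) (toℕ<n j))
          (subst₂ _∈_ (cong w (toℕ-inject₁ j)) (sym (Sℕ-lookup (sets σ) j)) caught)

Adjacent : ℕ → ℕ → Set
Adjacent a b = suc a ≡ b ⊎ suc b ≡ a

Adjacent-sym : Symmetric Adjacent
Adjacent-sym (inj₁ eq) = inj₂ eq
Adjacent-sym (inj₂ eq) = inj₁ eq

PathG-sym : ∀ {n} → Symmetric (PathG n)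
PathG-sym = Adjacent-sym

Adjacent-upper : ∀ {a b c} → Adjacent a b → b ≤ c → a ≤ suc c
Adjacent-upper (inj₁ refl) b≤c = m≤n⇒m≤1+n (≤-trans (n≤1+n _) b≤c)
Adjacent-upper (inj₂ refl) b≤c = s≤s b≤c

Adjacent-lower : ∀ {a b c} → Adjacent a b → suc c < b → c < a
Adjacent-lower (inj₁ refl) (s≤s c<a) = c<a
Adjacent-lower (inj₂ refl) 1+c<b     = m<n⇒m<1+n (<-trans (n<1+n _) 1+c<b)

Adjacent-∸ : ∀ {N a b} → a ≤ N → b ≤ N → Adjacent a b → Adjacent (N ∸ a) (N ∸ b)
Adjacent-∸ _   b≤N (inj₁ refl) = inj₂ (sym (+-∸-assoc 1 b≤N))
Adjacent-∸ a≤N _   (inj₂ refl) = inj₁ (sym (+-∸-assoc 1 a≤N))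

2+n≢n : ∀ n → suc (suc n) ≢ n
2+n≢n n eq = <-irrefl (sym eq) (m<n⇒m<1+n (n<1+n n))

parity-suc : ∀ n → parity (suc n) ≡ parity n ⁻¹
parity-suc zero          = refl
parity-suc (suc zero)    = refl
parity-suc (suc (suc n)) = parity-suc n

even-or-odd : ∀ a → parity a ≡ 0ℙ ⊎ (0 < a × parity a ≡ 1ℙ)
even-or-odd zero = inj₁ refl
even-or-odd (suc a) with parity (suc a)
... | 0ℙ = inj₁ refl
... | 1ℙ = inj₂ (s≤s z≤n , refl)

Adjacent-parity : ∀ {a b} → Adjacent a b → parity a ≡ parity b ⁻¹
Adjacent-parity {a} (inj₁ refl) = sym (⁻¹-selfInverse (sym (parity-suc a)))
Adjacent-parity {b = b} (inj₂ refl) = parity-suc b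

-- Contaminated vertices ahead of the hunter have the parity opposite to its own, so
-- contamination never jumps over it.
module Sweep {L : ℕ} (σ : Strategy (suc L)) (t : ℕ)
  (sweeping : ∀ k → k < L → ∀ y → toℕ y ≡ suc k → y ∈ Sℕ (sets σ) (t + k)) where
  private
    G = PathG (suc L)

  EvenContaminated : Set
  EvenContaminated = ∃ λ y → Z G σ t y × parity (toℕ y) ≡ 0ℙ

  sweep-invariant : ∀ k → k ≤ L → ∀ x → Z G σ (t + k) x →
    (parity (toℕ x) ≡ parity k × EvenContaminated) ⊎ (k < toℕ x × parity (toℕ x) ≡ parity (suc k))
  sweep-invariant zero _ x zx with even-or-odd (toℕ x)
  ... | inj₁ even       = inj₁ (even , x , subst (λ i → Z G σ i x) (+-identityʳ t) zx , even)
  ... | inj₂ (0<x , odd) = inj₂ (0<x , odd)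
  sweep-invariant (suc k) 1+k≤L x zx with subst (λ i → Z G σ i x) (+-suc t k) zx
  ... | y , zy , y∉S , xy with sweep-invariant k (<⇒≤ 1+k≤L) y zy
  ... | inj₁ (py , even) = inj₁ (trans (Adjacent-parity xy) (trans (cong _⁻¹ py) (sym (parity-suc k))) , even)
  ... | inj₂ (k<y , py)  = inj₂ (Adjacent-lower xy 2+k<y , px)
    where
    y≢1+k : toℕ y ≢ suc k
    y≢1+k y≡ = y∉S (sweeping k 1+k≤L y y≡)
    y≢2+k : toℕ y ≢ suc (suc k)
    y≢2+k y≡ = p≢p⁻¹ (parity k) (trans (sym (cong parity y≡)) (trans py (parity-suc k)))
    2+k<y : suc (suc k) < toℕ y
    2+k<y = ≤∧≢⇒< (≤∧≢⇒< k<y (y≢1+k ∘ sym)) (y≢2+k ∘ sym)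
    px : parity (toℕ x) ≡ parity (suc (suc k))
    px = trans (Adjacent-parity xy) (trans (cong _⁻¹ py) (sym (parity-suc (suc k))))

  after-sweep : ∀ x → Z G σ (t + L) x → parity (toℕ x) ≡ parity L × EvenContaminated
  after-sweep x zx with sweep-invariant L ≤-refl x zx
  ... | inj₁ result     = result
  ... | inj₂ (L<x , _) = ⊥-elim (<⇒≱ L<x (≤-pred (toℕ<n x)))

sweep : (L : ℕ) → Vec (Subset (suc L)) L
sweep L = tabulate (λ k → ⁅ suc k ⁆)

sweep-hunts : ∀ L {k} (k<L : k < L) y → toℕ y ≡ suc k → y ∈ Sℕ (sweep L) k
sweep-hunts L k<L y y≡1+k = subst (y ∈_) (sym (Sℕ-tabulate _ k<L))
  (subst (λ z → y ∈ ⁅ z ⁆) (toℕ-injective (trans y≡1+k (cong suc (sym (toℕ-fromℕ< k<L))))) (x∈⁅x⁆ y))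

-- After two sweeps only even vertices can be contaminated, and only if L is even; the round
-- ⁅ zero ⁆ turns them into odd ones, which the third sweep clears.
patrol : (L : ℕ) → Vec (Subset (suc L)) (L + (L + suc L))
patrol L = sweep L ++ sweep L ++ ⁅ zero ⁆ ∷ sweep L

patrol-singletons : ∀ L → All (λ s → ∃ λ x → s ≡ ⁅ x ⁆) (patrol L)
patrol-singletons L = ++⁺ sweep-singletons (++⁺ sweep-singletons ((zero , refl) ∷ sweep-singletons))
  where
  sweep-singletons : All (λ s → ∃ λ x → s ≡ ⁅ x ⁆) (sweep L)
  sweep-singletons = tabulate⁺ (λ k → suc k , refl)

patrolStrategy : (L : ℕ) → Strategy (suc L)
patrolStrategy L = strategyOf (patrol L) (All.map (λ { (x , refl) → x , x∈⁅x⁆ x }) (patrol-singletons L))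

third-sweep-round : ∀ L k → suc (L + L) + k ≡ L + (L + suc k)
third-sweep-round L k = trans (cong suc (+-assoc L L k)) (trans (sym (+-suc L (L + k))) (cong (L +_) (sym (+-suc L k))))

patrol-winning : ∀ L → Winning (PathG (suc L)) (patrolStrategy L)
patrol-winning L = Z-empty⇒winning PathG-sym σ empty
  where
  σ = patrolStrategy L
  sw = sweep L
  module First = Sweep σ 0 (λ k k<L y y≡ →
    subst (y ∈_) (sym (Sℕ-++ˡ sw _ k<L)) (sweep-hunts L k<L y y≡))
  module Second = Sweep σ L (λ k k<L y y≡ →
    subst (y ∈_) (sym (trans (Sℕ-++ʳ sw _ k) (Sℕ-++ˡ sw _ k<L))) (sweep-hunts L k<L y y≡))
  module Third = Sweep σ (suc (L + L)) (λ k k<L y y≡ →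
    subst (y ∈_) (sym (trans (cong (Sℕ (patrol L)) (third-sweep-round L k))
                             (trans (Sℕ-++ʳ sw _ (L + suc k)) (Sℕ-++ʳ sw _ (suc k)))))
      (sweep-hunts L k<L y y≡))
  empty : ∀ x → ¬ Z (PathG (suc L)) σ (L + (L + suc L)) x
  empty x zx with Third.after-sweep x (subst (λ i → Z (PathG (suc L)) σ i x) (sym (third-sweep-round L L)) zx)
  ... | _ , y , (z , zz , _ , yz) , y-even with Second.after-sweep z zz
  ... | z≡L , w , zw , w-even = p≢p⁻¹ 0ℙ (begin
    0ℙ                 ≡⟨ sym y-even ⟩
    parity (toℕ y)     ≡⟨ Adjacent-parity yz ⟩
    parity (toℕ z) ⁻¹  ≡⟨ cong _⁻¹ (trans z≡L (trans (sym (proj₁ (First.after-sweep w zw))) w-even)) ⟩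
    0ℙ ⁻¹              ∎)
    where
    open ≡-Reasoning

pathHunterNumber : ∀ L → HunterNumber (PathG (suc L)) 1
pathHunterNumber L =
  (patrolStrategy L , patrol-winning L ,
    ≤-antisym (maxCard≤ (All.map (λ { (x , refl) → ≤-reflexive (∣⁅x⁆∣≡1 x) }) (patrol-singletons L)))
              (winning⇒1≤hunters {G = PathG (suc L)} zero (patrolStrategy L) (patrol-winning L))) ,
  winning⇒1≤hunters {G = PathG (suc L)} zero

module PairSweep (L : ℕ) where
  private
    G = PathG (suc L)

  pairSweep : Vec (Subset (suc L)) L
  pairSweep = tabulate (λ k → ⁅ inject₁ k ⁆ ∪ ⁅ suc k ⁆)

  pairStrategy : Strategy (suc L)
  pairStrategy = strategy L pairSweep (λ k → inject₁ k ,
    subst (inject₁ k ∈_) (sym (lookup∘tabulate _ k)) (x∈p∪q⁺ (inj₁ (x∈⁅x⁆ _))))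

  pairStrategy-hunters : hunters pairStrategy ≤ 2
  pairStrategy-hunters = maxCard≤ {v = pairSweep} (tabulate⁺ λ k →
    ≤-trans (∣p∪q∣≤∣p∣+∣q∣ ⁅ inject₁ k ⁆ ⁅ suc k ⁆)
            (≤-reflexive (cong₂ _+_ (∣⁅x⁆∣≡1 (inject₁ k)) (∣⁅x⁆∣≡1 (suc k)))))

  ∈pairSweep⁻ : ∀ {j} (j<L : j < L) {y} → y ∈ Sℕ pairSweep j → toℕ y ≡ j ⊎ toℕ y ≡ suc j
  ∈pairSweep⁻ j<L {y} y∈S with x∈p∪q⁻ _ _ (subst (y ∈_) (Sℕ-tabulate _ j<L) y∈S)
  ... | inj₁ y∈ = inj₁ (trans (cong toℕ (x∈⁅y⁆⇒x≡y _ y∈)) (trans (toℕ-inject₁ _) (toℕ-fromℕ< j<L)))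
  ... | inj₂ y∈ = inj₂ (trans (cong toℕ (x∈⁅y⁆⇒x≡y _ y∈)) (cong suc (toℕ-fromℕ< j<L)))

  ∈pairSweep⁺ : ∀ {j} (j<L : j < L) {y} → toℕ y ≡ j ⊎ toℕ y ≡ suc j → y ∈ Sℕ pairSweep j
  ∈pairSweep⁺ j<L {y} y≡ = subst (y ∈_) (sym (Sℕ-tabulate _ j<L)) (x∈p∪q⁺ (Data.Sum.map
    (λ y≡j → ∈⁅⁆ (trans y≡j (sym (trans (toℕ-inject₁ _) (toℕ-fromℕ< j<L)))))
    (λ y≡1+j → ∈⁅⁆ (trans y≡1+j (sym (cong suc (toℕ-fromℕ< j<L)))))
    y≡))
    where
    ∈⁅⁆ : ∀ {z} → toℕ y ≡ toℕ z → y ∈ ⁅ z ⁆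
    ∈⁅⁆ y≡z = subst (λ z → y ∈ ⁅ z ⁆) (toℕ-injective y≡z) (x∈⁅x⁆ y)

  ∉pairSweep : ∀ {j} → j < L → ∀ {y} → j ≤ toℕ y → y ∉ Sℕ pairSweep j → suc j < toℕ y
  ∉pairSweep j<L j≤y y∉S =
    ≤∧≢⇒< (≤∧≢⇒< j≤y (λ j≡y → y∉S (∈pairSweep⁺ j<L (inj₁ (sym j≡y)))))
          (λ 1+j≡y → y∉S (∈pairSweep⁺ j<L (inj₂ (sym 1+j≡y))))

  contaminated-ahead : ∀ j → j ≤ L → ∀ x → Z G pairStrategy j x → j ≤ toℕ x
  contaminated-ahead zero    _       x _                  = z≤n
  contaminated-ahead (suc j) 1+j≤L x (y , zy , y∉S , xy) =
    Adjacent-lower xy (∉pairSweep 1+j≤L (contaminated-ahead j (<⇒≤ 1+j≤L) y zy) y∉S)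

  hunted-near : ∀ k {u} → u ∈ lookup pairSweep k → toℕ u ≤ suc (toℕ k)
  hunted-near k {u} u∈S with ∈pairSweep⁻ (toℕ<n k) (subst (u ∈_) (sym (Sℕ-lookup pairSweep k)) u∈S)
  ... | inj₁ u≡k   = m≤n⇒m≤1+n (≤-reflexive u≡k)
  ... | inj₂ u≡1+k = ≤-reflexive u≡1+k

  cleared-behind : ∀ k v → Cleared G pairStrategy k v → toℕ v ≤ suc (suc (toℕ k))
  cleared-behind k v (inj₁ v∈S)                      = m≤n⇒m≤1+n (hunted-near k v∈S)
  cleared-behind k v (inj₂ ((u , vu , zu) , hunted)) = Adjacent-upper vu (hunted-near k (hunted u vu zu))

  pairStrategy-monotone : Monotone G pairStrategy
  pairStrategy-monotone v k j cleared 1+k<j zj =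
    subst (v ∈_) (Sℕ-lookup pairSweep j) (∈pairSweep⁺ (toℕ<n j) (inj₁ v≡j))
    where
    v≡j : toℕ v ≡ toℕ j
    v≡j = ≤-antisym (≤-trans (cleared-behind k v cleared) 1+k<j)
                    (contaminated-ahead (toℕ j) (<⇒≤ (toℕ<n j)) v zj)

pairStrategy-winning : ∀ L → Winning (PathG (suc (suc L))) (PairSweep.pairStrategy (suc L))
pairStrategy-winning L = Z-empty⇒winning PathG-sym pairStrategy empty
  where
  open PairSweep (suc L)
  empty : ∀ x → ¬ Z (PathG (suc (suc L))) pairStrategy (suc L) x
  empty x (y , zy , y∉S , _) =
    <⇒≱ (∉pairSweep ≤-refl (contaminated-ahead L (n≤1+n L) y zy) y∉S) (≤-pred (toℕ<n y))

data End : Set where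
  left right : End

other : End → End
other left  = right
other right = left

module PathEnds (N : ℕ) where
  private
    G = PathG (suc N)

  dist : End → Fin (suc N) → ℕ
  dist left  x = toℕ x
  dist right x = N ∸ toℕ x

  dist≤N : ∀ e x → dist e x ≤ N
  dist≤N left  x = ≤-pred (toℕ<n x)
  dist≤N right x = m∸n≤m N (toℕ x)

  dist-other : ∀ e x → dist (other e) x ≡ N ∸ dist e x
  dist-other left  x = refl
  dist-other right x = sym (m∸[m∸n]≡n (dist≤N left x))

  at : End → (c : ℕ) → c ≤ N → Fin (suc N)
  at left  c c≤N = fromℕ< (s≤s c≤N)
  at right c c≤N = fromℕ< (s≤s (m∸n≤m N c))

  dist-at : ∀ e c (c≤N : c ≤ N) → dist e (at e c c≤N) ≡ c
  dist-at left  c c≤N = toℕ-fromℕ< (s≤s c≤N)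
  dist-at right c c≤N = trans (cong (N ∸_) (toℕ-fromℕ< (s≤s (m∸n≤m N c)))) (m∸[m∸n]≡n c≤N)

  dist-injective : ∀ e {x y} → dist e x ≡ dist e y → x ≡ y
  dist-injective left  eq = toℕ-injective eq
  dist-injective right {x} {y} eq = toℕ-injective (∸-cancelˡ-≡ (dist≤N left x) (dist≤N left y) eq)

  adjacent⇒ : ∀ e {x y} → G x y → Adjacent (dist e x) (dist e y)
  adjacent⇒ left  xy = xy
  adjacent⇒ right xy = Adjacent-∸ (dist≤N left _) (dist≤N left _) xy

  adjacent⇐ : ∀ e {x y} → Adjacent (dist e x) (dist e y) → G x y
  adjacent⇐ left  xy = xy
  adjacent⇐ right {x} {y} xy = subst₂ Adjacent (m∸[m∸n]≡n (dist≤N left x)) (m∸[m∸n]≡n (dist≤N left y))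
    (Adjacent-∸ (dist≤N right x) (dist≤N right y) xy)

module OneHunter (m : ℕ) (σ : Strategy (4 + m)) (monotone : Monotone (PathG (4 + m)) σ)
                 (one-hunter : hunters σ ≤ 1) where
  open PathEnds (3 + m)
  private
    N = 3 + m
    V = Fin (4 + m)
    G = PathG (4 + m)
    ℓ = len σ
    S = Sℕ (sets σ)

  Contaminated : ℕ → V → Set
  Contaminated = Z G σ

  Hunted : ℕ → V → Set
  Hunted t s = s ∈ S t × ∀ v → v ∈ S t → v ≡ s

  S-fromℕ< : ∀ {t} (t<ℓ : t < ℓ) → S t ≡ lookup (sets σ) (fromℕ< t<ℓ)
  S-fromℕ< t<ℓ = trans (cong S (sym (toℕ-fromℕ< t<ℓ))) (Sℕ-lookup (sets σ) (fromℕ< t<ℓ))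

  hunter : ∀ {t} → t < ℓ → ∃ (Hunted t)
  hunter t<ℓ with nonempty σ (fromℕ< t<ℓ)
  ... | s , s∈S = s , subst (s ∈_) (sym (S-fromℕ< t<ℓ)) s∈S , λ v v∈S →
    ∣p∣≤1⇒≡ _ (≤-trans (∣lookup∣≤maxCard (sets σ) (fromℕ< t<ℓ)) one-hunter)
              (subst (v ∈_) (S-fromℕ< t<ℓ) v∈S) s∈S

  -- Cleared in round k + 1 < t, so monotonicity applies to v from Z_t on.
  ClearedBefore : ℕ → V → Set
  ClearedBefore t v = ∃ λ (k : Fin ℓ) → Cleared G σ k v × suc (toℕ k) < t

  ClearedBefore-suc : ∀ {t v} → ClearedBefore t v → ClearedBefore (suc t) v
  ClearedBefore-suc (k , cleared , 1+k<t) = k , cleared , m<n⇒m<1+n 1+k<t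

  guarded : ∀ {t v} → t < ℓ → ClearedBefore t v → Contaminated t v → v ∈ S t
  guarded t<ℓ (k , cleared , 1+k<t) zv = subst (_ ∈_) (sym (S-fromℕ< t<ℓ))
    (monotone _ k (fromℕ< t<ℓ) cleared (subst (suc (toℕ k) <_) (sym (toℕ-fromℕ< t<ℓ)) 1+k<t)
              (subst (λ i → Contaminated i _) (sym (toℕ-fromℕ< t<ℓ)) zv))

  ClearedIn : ℕ → V → Set
  ClearedIn t v =
    v ∈ S t ⊎ ((∃ λ u → G v u × Contaminated t u) × (∀ u → G v u → Contaminated t u → u ∈ S t))

  ClearedIn⇒Cleared : ∀ k {v} → ClearedIn (toℕ k) v → Cleared G σ k v
  ClearedIn⇒Cleared k (inj₁ v∈S)            = inj₁ (subst (_ ∈_) (Sℕ-lookup (sets σ) k) v∈S)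
  ClearedIn⇒Cleared k (inj₂ (some , hunted)) =
    inj₂ (some , λ u vu zu → subst (u ∈_) (Sℕ-lookup (sets σ) k) (hunted u vu zu))

  cleared-in : ∀ {t v} → t < ℓ → ClearedIn t v → ClearedBefore (2 + t) v
  cleared-in {v = v} t<ℓ c =
    fromℕ< t<ℓ , ClearedIn⇒Cleared _ (subst (λ i → ClearedIn i v) (sym (toℕ-fromℕ< t<ℓ)) c) ,
    s≤s (s≤s (≤-reflexive (toℕ-fromℕ< t<ℓ)))

  ContaminatedAt ContaminatedExcept ClearedAt : End → ℕ → ℕ → Set
  ContaminatedAt     e t c = ∀ x → dist e x ≡ c → Contaminated t x
  ContaminatedExcept e t c = ∀ x → dist e x ≢ c → Contaminated t x
  ClearedAt          e t c = ∀ x → dist e x ≡ c → ClearedBefore t x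

  except⇒at : ∀ e {t a c} → ContaminatedExcept e t a → c ≢ a → ContaminatedAt e t c
  except⇒at e z c≢a x x≡c = z x (λ x≡a → c≢a (trans (sym x≡c) x≡a))

  spread : ∀ {t s} → Hunted t s → ∀ e x {c} → Adjacent (dist e x) c → c ≤ N → dist e s ≢ c →
    ContaminatedAt e t c → Contaminated (suc t) x
  spread (_ , only-s) e x {c} xc c≤N s≢c zc =
    y , zc y y≡c , (λ y∈S → s≢c (trans (cong (dist e) (sym (only-s y y∈S))) y≡c)) ,
    adjacent⇐ e (subst (Adjacent (dist e x)) (sym y≡c) xc)
    where
    y = at e c c≤N
    y≡c = dist-at e c c≤N

  spread-up : ∀ {t s} → Hunted t s → ∀ e x {c} → suc (dist e x) ≡ c → c ≤ N → dist e s ≢ c →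
    ContaminatedAt e t c → Contaminated (suc t) x
  spread-up hs e x up = spread hs e x (inj₁ up)

  spread-down : ∀ {t s} → Hunted t s → ∀ e x {c} → suc c ≡ dist e x → dist e s ≢ c →
    ContaminatedAt e t c → Contaminated (suc t) x
  spread-down hs e x down = spread hs e x (inj₂ down) (≤-trans (n≤1+n _) (subst (_≤ N) (sym down) (dist≤N e x)))

  guarded-position : ∀ {t s} → t < ℓ → Hunted t s → ∀ e {c} → c ≤ N →
    ContaminatedAt e t c → ClearedAt e t c → dist e s ≡ c
  guarded-position t<ℓ (_ , only-s) e {c} c≤N zc fc =
    trans (cong (dist e) (sym (only-s v (guarded t<ℓ (fc v v≡c) (zc v v≡c))))) v≡c
    where
    v = at e c c≤N
    v≡c = dist-at e c c≤N

  hunted-cleared : ∀ {t s} → t < ℓ → Hunted t s → ∀ e {c} → dist e s ≡ c → ClearedAt e (2 + t) c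
  hunted-cleared t<ℓ (s∈S , _) e s≡c v v≡c =
    cleared-in t<ℓ (inj₁ (subst (_∈ S _) (dist-injective e (trans s≡c (sym v≡c))) s∈S))

  neighbour-clears-end : ∀ {t s} → t < ℓ → Hunted t s → Contaminated t s → ∀ e → dist e s ≡ 1 →
    ClearedAt e (2 + t) 0
  neighbour-clears-end t<ℓ (s∈S , _) zs e s≡1 v v≡0 = cleared-in t<ℓ (inj₂ ((_ , vs , zs) , only-neighbour))
    where
    vs : G v _
    vs = adjacent⇐ e (inj₁ (trans (cong suc v≡0) (sym s≡1)))
    only-neighbour : ∀ u → G v u → Contaminated _ u → u ∈ S _
    only-neighbour u vu _ with adjacent⇒ e vu
    ... | inj₁ v+1≡u = subst (_∈ S _) (dist-injective e (trans s≡1 (trans (cong suc (sym v≡0)) v+1≡u))) s∈S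
    ... | inj₂ u+1≡v = ⊥-elim (1+n≢0 (trans u+1≡v v≡0))

  at-far-end : ∀ e x {d} → dist e x ≡ d → ¬ suc d ≤ N → suc (suc (suc m)) ≡ dist e x
  at-far-end e x refl ¬up = ≤-antisym (≮⇒≥ ¬up) (dist≤N e x)

  far-end⇒other-0 : ∀ e {x} → dist e x ≡ N → dist (other e) x ≡ 0
  far-end⇒other-0 e {x} x≡N = trans (dist-other e x) (trans (cong (N ∸_) x≡N) (n∸n≡0 N))

  other-1⇒ : ∀ e {x} → dist (other e) x ≡ 1 → dist e x ≡ suc (suc m)
  other-1⇒ e {x} x≡1 = trans (sym (m∸[m∸n]≡n (dist≤N e x))) (cong (N ∸_) (trans (sym (dist-other e x)) x≡1))

  ⇒other-1 : ∀ e {x} → dist e x ≡ suc (suc m) → dist (other e) x ≡ 1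
  ⇒other-1 e {x} x≡ = trans (dist-other e x) (trans (cong (N ∸_) x≡) (m+n∸n≡m 1 m))

  except₀-step : ∀ {t s} → Hunted t s → ∀ e → ContaminatedExcept e t 0 → dist e s ≡ 1 →
    ContaminatedExcept e (suc t) 0
  except₀-step hs e z s≡1 x x≢0 with suc (dist e x) ≤? N
  ... | yes up = spread-up hs e x refl up (λ s≡ → x≢0 (sym (suc-injective (trans (sym s≡1) s≡))))
                   (except⇒at e z λ ())
  ... | no ¬up = spread-down hs e x (at-far-end e x refl ¬up)
                   (λ s≡ → 0≢1+n (suc-injective (trans (sym s≡1) s≡)))
                   (except⇒at e z λ ())

  except₁-step : ∀ {t s} → Hunted t s → ∀ e → ContaminatedExcept e t 0 → dist e s ≡ 2 → m ≢ 0 →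
    ContaminatedExcept e (suc t) 1
  except₁-step hs e z s≡2 m≢0 x x≢1 with dist e x in x≡
  ... | zero        = spread-up hs e x (cong suc x≡) (s≤s z≤n) (λ s≡1 → 1+n≢n (trans (sym s≡2) s≡1))
                        (except⇒at e z λ ())
  ... | suc zero    = ⊥-elim (x≢1 refl)
  ... | suc (suc c) with suc (suc (suc c)) ≤? N
  ...   | yes up = spread-up hs e x (cong suc x≡) up
                     (λ s≡ → 0≢1+n (suc-injective (suc-injective (trans (sym s≡2) s≡)))) (except⇒at e z λ ())
  ...   | no ¬up = spread-down hs e x (at-far-end e x x≡ ¬up)
                     (λ s≡ → m≢0 (suc-injective (suc-injective (trans (sym s≡) s≡2)))) (except⇒at e z λ ())

  all-step : ∀ {t s} → Hunted t s → ∀ e → ContaminatedExcept e t 0 →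
    (dist e s ≢ 2 ⊎ ContaminatedAt e t 0) → dist e s ≢ 1 → dist (other e) s ≢ 1 → ∀ x → Contaminated (suc t) x
  all-step {t} {s} hs e z s≢2-or-z0 s≢1 s≢far x with dist e x in x≡
  ... | zero = spread-up hs e x (cong suc x≡) (s≤s z≤n) s≢1 (except⇒at e z λ ())
  ... | suc c with suc (suc c) ≤? N
  ...   | no ¬up = spread-down hs e x (at-far-end e x x≡ ¬up) (s≢far ∘ ⇒other-1 e) (except⇒at e z λ ())
  ...   | yes up with dist e s ≟ suc (suc c)
  ...     | no s≢  = spread-up hs e x (cong suc x≡) up s≢ (except⇒at e z λ ())
  ...     | yes s≡ = spread-down hs e x (sym x≡) (λ s≡c → 2+n≢n c (trans (sym s≡) s≡c)) (below c s≡)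
    where
    below : ∀ c → dist e s ≡ suc (suc c) → ContaminatedAt e t c
    below zero    s≡2 = [ (λ s≢2 → ⊥-elim (s≢2 s≡2)) , id ]′ s≢2-or-z0
    below (suc c) _ = except⇒at e z λ ()

  far-step : ∀ {t s} → Hunted t s → ∀ e → ContaminatedExcept e t 0 → dist e s ≢ 1 → dist e s ≢ 2 →
    dist (other e) s ≡ 1 → ContaminatedExcept (other e) (suc t) 0
  far-step {s = s} hs e z s≢1 s≢2 s-far x x≢far with dist e x in x≡
  ... | zero        = spread-up hs e x (cong suc x≡) (s≤s z≤n) s≢1 (except⇒at e z λ ())
  ... | suc zero    = spread-up hs e x (cong suc x≡) (s≤s (s≤s z≤n)) s≢2 (except⇒at e z λ ())
  ... | suc (suc c) = spread-down hs e x (sym x≡) s≢1+c (except⇒at e z λ ())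
    where
    s≢1+c : dist e s ≢ suc c
    s≢1+c s≡ = x≢far (far-end⇒other-0 e (trans x≡ (cong suc (trans (sym s≡) (other-1⇒ e s-far)))))

  guard-step : ∀ {t s} → Hunted t s → ∀ e → ContaminatedExcept e t 1 → dist e s ≡ 0 →
    ContaminatedExcept e (suc t) 0
  guard-step hs e z s≡0 x x≢0 with suc (dist e x) ≤? N
  ... | yes up = spread-up hs e x refl up (λ s≡ → 0≢1+n (trans (sym s≡0) s≡))
                   (except⇒at e z (x≢0 ∘ suc-injective))
  ... | no ¬up = spread-down hs e x (at-far-end e x refl ¬up) (λ s≡ → 0≢1+n (trans (sym s≡0) s≡))
                   (except⇒at e z λ ())

  -- The last three stages only occur when m ≡ 0, that is, on four vertices.
  data Stage (t : ℕ) : Set where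
    everywhere  : (∀ x → Contaminated t x) → Stage t
    end-cleared : ∀ e → ContaminatedExcept e t 0 → ClearedAt e (suc t) 0 → Stage t
    end-guarded : ∀ e → ContaminatedExcept e t 1 → ClearedAt e t 0 → Stage t
    even-pair   : ∀ e → ContaminatedAt e t 0 → ContaminatedAt e t 2 → ClearedAt e t 0 →
                  ClearedAt e (suc t) 2 → ClearedAt e (suc t) 3 → Stage t
    odd-pair    : ∀ e → ContaminatedAt e t 1 → ContaminatedAt e t 3 → ClearedAt e t 3 →
                  ClearedAt e t 2 → ClearedAt e (suc t) 0 → Stage t
    deadlock    : ∀ e → ContaminatedAt e t 0 → ContaminatedAt e t 2 → ClearedAt e t 0 → ClearedAt e t 2 → Stage t

  everywhere-step : ∀ {t} → t < ℓ → (∀ x → Contaminated t x) → Stage (suc t)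
  everywhere-step t<ℓ z with hunter t<ℓ
  ... | s , hs with dist left s ≟ 1 | dist right s ≟ 1
  ... | yes s≡1 | _        = end-cleared left (except₀-step hs left (λ x _ → z x) s≡1)
                               (neighbour-clears-end t<ℓ hs (z s) left s≡1)
  ... | no _    | yes s≡1  = end-cleared right (except₀-step hs right (λ x _ → z x) s≡1)
                               (neighbour-clears-end t<ℓ hs (z s) right s≡1)
  ... | no s≢1  | no s≢far = everywhere (all-step hs left (λ x _ → z x) (inj₂ (λ x _ → z x)) s≢1 s≢far)

  end-cleared-hunter-at-2 : ∀ {t s} → t < ℓ → Hunted t s → ∀ e → ContaminatedExcept e t 0 →
    ClearedAt e (suc t) 0 → dist e s ≡ 2 → Stage (suc t)
  end-cleared-hunter-at-2 {t} {s} t<ℓ hs e z f0 s≡2 with m ≟ 0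
  ... | no m≢0  = end-guarded e (except₁-step hs e z s≡2 m≢0) f0
  ... | yes m≡0 = even-pair e z0 z2 f0 (hunted-cleared t<ℓ hs e s≡2) f3
    where
    z0 : ContaminatedAt e (suc t) 0
    z0 x x≡0 = spread-up hs e x (cong suc x≡0) (s≤s z≤n) (λ s≡1 → 1+n≢n (trans (sym s≡2) s≡1))
                 (except⇒at e z λ ())
    z2 : ContaminatedAt e (suc t) 2
    z2 x x≡2 = spread-up hs e x (cong suc x≡2) (s≤s (s≤s (s≤s z≤n)))
                 (λ s≡3 → 1+n≢n (sym (trans (sym s≡2) s≡3)))
                 (except⇒at e z λ ())
    f3 : ClearedAt e (2 + t) 3
    f3 x x≡3 = neighbour-clears-end t<ℓ hs (z s (λ s≡0 → 1+n≢0 (trans (sym s≡2) s≡0))) (other e)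
                 (⇒other-1 e (trans s≡2 (cong (λ k → suc (suc k)) (sym m≡0))))
                 x (far-end⇒other-0 e (trans x≡3 (cong (3 +_) (sym m≡0))))

  end-cleared-step : ∀ {t} → t < ℓ → ∀ e → ContaminatedExcept e t 0 → ClearedAt e (suc t) 0 → Stage (suc t)
  end-cleared-step t<ℓ e z f0 with hunter t<ℓ
  ... | s , hs with dist e s ≟ 1 | dist e s ≟ 2 | dist (other e) s ≟ 1
  ... | yes s≡1 | _       | _         = end-cleared e (except₀-step hs e z s≡1)
                                          (λ x x≡0 → ClearedBefore-suc (f0 x x≡0))
  ... | no _    | yes s≡2 | _         = end-cleared-hunter-at-2 t<ℓ hs e z f0 s≡2
  ... | no s≢1  | no s≢2  | yes s-far = end-cleared (other e) (far-step hs e z s≢1 s≢2 s-far)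
                                          (neighbour-clears-end t<ℓ hs (z s s≢0) (other e) s-far)
    where
    s≢0 : dist e s ≢ 0
    s≢0 s≡0 = 1+n≢0 (trans (sym (other-1⇒ e s-far)) s≡0)
  ... | no s≢1  | no s≢2  | no s≢far  = everywhere (all-step hs e z (inj₁ s≢2) s≢1 s≢far)

  end-guarded-step : ∀ {t} → t < ℓ → ∀ e → ContaminatedExcept e t 1 → ClearedAt e t 0 → Stage (suc t)
  end-guarded-step t<ℓ e z f0 with hunter t<ℓ
  ... | s , hs = end-cleared e (guard-step hs e z s≡0) (hunted-cleared t<ℓ hs e s≡0)
    where
    s≡0 : dist e s ≡ 0
    s≡0 = guarded-position t<ℓ hs e z≤n (except⇒at e z λ ()) f0

  even-pair-step : ∀ {t} → t < ℓ → ∀ e → ContaminatedAt e t 0 → ContaminatedAt e t 2 → ClearedAt e t 0 →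
    ClearedAt e (suc t) 2 → ClearedAt e (suc t) 3 → Stage (suc t)
  even-pair-step t<ℓ e z0 z2 f0 f2 f3 with hunter t<ℓ
  ... | s , hs = odd-pair e z1 z3 f3 f2 (hunted-cleared t<ℓ hs e s≡0)
    where
    s≡0 : dist e s ≡ 0
    s≡0 = guarded-position t<ℓ hs e z≤n z0 f0
    s≢2 : dist e s ≢ 2
    s≢2 s≡2 = 1+n≢0 (trans (sym s≡2) s≡0)
    z1 : ContaminatedAt e _ 1
    z1 x x≡1 = spread-up hs e x (cong suc x≡1) (s≤s (s≤s z≤n)) s≢2 z2
    z3 : ContaminatedAt e _ 3
    z3 x x≡3 = spread-down hs e x (sym x≡3) s≢2 z2

  odd-pair-step : ∀ {t} → t < ℓ → ∀ e → ContaminatedAt e t 1 → ContaminatedAt e t 3 → ClearedAt e t 3 →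
    ClearedAt e t 2 → ClearedAt e (suc t) 0 → Stage (suc t)
  odd-pair-step t<ℓ e z1 z3 f3 f2 f0 with hunter t<ℓ
  ... | s , hs = deadlock e z0 z2 f0 (λ x x≡2 → ClearedBefore-suc (f2 x x≡2))
    where
    s≢1 : dist e s ≢ 1
    s≢1 s≡1 = 1+n≢0 (suc-injective
      (trans (sym (guarded-position t<ℓ hs e (s≤s (s≤s (s≤s z≤n))) z3 f3)) s≡1))
    z0 : ContaminatedAt e _ 0
    z0 x x≡0 = spread-up hs e x (cong suc x≡0) (s≤s z≤n) s≢1 z1
    z2 : ContaminatedAt e _ 2
    z2 x x≡2 = spread-down hs e x (sym x≡2) s≢1 z1

  deadlock-impossible : ∀ {t} → t < ℓ → ∀ e → ContaminatedAt e t 0 → ContaminatedAt e t 2 →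
    ClearedAt e t 0 → ClearedAt e t 2 → ⊥
  deadlock-impossible t<ℓ e z0 z2 f0 f2 with hunter t<ℓ
  ... | s , hs = 0≢1+n (trans (sym (guarded-position t<ℓ hs e z≤n z0 f0))
                             (guarded-position t<ℓ hs e (s≤s (s≤s z≤n)) z2 f2))

  step : ∀ {t} → t < ℓ → Stage t → Stage (suc t)
  step t<ℓ (everywhere z)                    = everywhere-step t<ℓ z
  step t<ℓ (end-cleared e z f0)              = end-cleared-step t<ℓ e z f0
  step t<ℓ (end-guarded e z f0)              = end-guarded-step t<ℓ e z f0
  step t<ℓ (even-pair e z0 z2 f0 f2 f3)      = even-pair-step t<ℓ e z0 z2 f0 f2 f3
  step t<ℓ (odd-pair e z1 z3 f3 f2 f0)       = odd-pair-step t<ℓ e z1 z3 f3 f2 f0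
  step t<ℓ (deadlock e z0 z2 f0 f2)          = ⊥-elim (deadlock-impossible t<ℓ e z0 z2 f0 f2)

  stage : ∀ t → t ≤ ℓ → Stage t
  stage zero    _     = everywhere (λ _ → tt)
  stage (suc t) 1+t≤ℓ = step 1+t≤ℓ (stage t (<⇒≤ 1+t≤ℓ))

  stage-contaminated : ∀ {t} → Stage t → ∃ (Contaminated t)
  stage-contaminated (everywhere z)            = zero , z zero
  stage-contaminated (end-cleared e z _)       =
    at e 1 (s≤s z≤n) , z _ (λ x≡0 → 1+n≢0 (trans (sym (dist-at e 1 _)) x≡0))
  stage-contaminated (end-guarded e z _)       =
    at e 0 z≤n , z _ (λ x≡1 → 0≢1+n (trans (sym (dist-at e 0 _)) x≡1))
  stage-contaminated (even-pair e z0 _ _ _ _)  = at e 0 z≤n , z0 _ (dist-at e 0 _)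
  stage-contaminated (odd-pair e z1 _ _ _ _)   = at e 1 (s≤s z≤n) , z1 _ (dist-at e 1 _)
  stage-contaminated (deadlock e z0 _ _ _)     = at e 0 z≤n , z0 _ (dist-at e 0 _)

  not-winning : ¬ Winning G σ
  not-winning win with stage-contaminated (stage ℓ ≤-refl)
  ... | x , zx = winning⇒Z-empty PathG-sym σ win x zx

monotone-winning⇒2≤hunters : ∀ m σ → Winning (PathG (4 + m)) σ → Monotone (PathG (4 + m)) σ → 2 ≤ hunters σ
monotone-winning⇒2≤hunters m σ win mono with 2 ≤? hunters σ
... | yes 2≤h = 2≤h
... | no  2≰h = ⊥-elim (OneHunter.not-winning m σ mono (≤-pred (≰⇒> 2≰h)) win)

proposition4p10 : (n : ℕ) → 4 ≤ n →
    HunterNumber (PathG n) 1 × MonotoneHunterNumber (PathG n) 2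
proposition4p10 (suc (suc (suc (suc m)))) (s≤s (s≤s (s≤s (s≤s _)))) =
  pathHunterNumber (3 + m) ,
  (pairStrategy , pairStrategy-winning (2 + m) , pairStrategy-monotone ,
    ≤-antisym pairStrategy-hunters
      (monotone-winning⇒2≤hunters m pairStrategy (pairStrategy-winning (2 + m)) pairStrategy-monotone)) ,
  monotone-winning⇒2≤hunters m
  where
  open PairSweep (3 + m)
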